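{- Let $n\ge 1$ and $s$ be integers with $0\le s\le n-1$, and let $m$ be an indeterminate. Define the $n\times n$ matrix $(B_{ij})_{1\le i,j\le n}$ of polynomials in $m$ by $$B_{ij}=\begin{cases}(n+2+j-2i)_{n-j}\,(i+m+1-j)_{j-1}\left(m+\frac{n}{2}+\frac12-\frac{j}{2}\right), & i\ne s+1,\\ (n+1+j-2s)_{n-j}\,(s+m+1-j)_{j-1}, & i=s+1.\end{cases}$$ Then the leading coefficient of $\det_{1\le i,j\le n}(B_{ij})$ as a polynomial in $m$ is $$\frac{2^{\binom{n-1}{2}}\,\mathrm{h}(n)\,(2n-2s-1)!!\,(2s-1)!!}{(n-s-1)!\,s!}.$$
   Context: $(a)_k=a(a+1)\cdots(a+k-1)$ denotes the shifted factorial, with $(a)_0=1$. $\mathrm{h}(n)=\prod_{i=0}^{n-1} i!$. $(2k-1)!!=1\cdot3\cdots(2k-1)$, with $(-1)!!=1$. -}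

module Defs where

open import Data.Nat as ℕ using (ℕ; zero; suc; _∸_; _!)
open import Data.Nat.Properties using (_!*_!≢0)
open import Data.Nat.Combinatorics using (_C_)
open import Data.Integer as ℤ using (ℤ; +_)
open import Data.Rational as ℚ using (ℚ; 0ℚ; 1ℚ; _/_)
open import Data.Rational.Properties using (_≟_)
open import Data.List using (List; []; _∷_; map)
open import Data.Fin using (Fin; toℕ; punchIn) renaming (zero to Fz; suc to Fs)
open import Relation.Nullary using (yes; no)

-- Univariate polynomials over ℚ in the indeterminate m,
-- as coefficient lists, lowest degree first.

Poly : Set
Poly = List ℚ

infixl 6 _+P_
infixl 7 _*P_

_+P_ : Poly → Poly → Poly
[]      +P q       = q
p       +P []      = p
(a ∷ p) +P (b ∷ q) = (a ℚ.+ b) ∷ (p +P q)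

_*P_ : Poly → Poly → Poly
[]      *P q = []
(a ∷ p) *P q = map (a ℚ.*_) q +P (0ℚ ∷ (p *P q))

cst : ℚ → Poly
cst c = c ∷ []

X : Poly
X = 0ℚ ∷ 1ℚ ∷ []

ℤ→ℚ : ℤ → ℚ
ℤ→ℚ z = z / 1

ℕ→ℚ : ℕ → ℚ
ℕ→ℚ k = ℤ→ℚ (+ k)

leadCoeff : Poly → ℚ
leadCoeff []      = 0ℚ
leadCoeff (a ∷ p) with leadCoeff p ≟ 0ℚ
... | yes _ = a
... | no  _ = leadCoeff p

poch : Poly → ℕ → Poly
poch p zero    = cst 1ℚ
poch p (suc k) = poch p k *P (p +P cst (ℕ→ℚ k))

sumP : ∀ {n} → (Fin n → Poly) → Poly
sumP {zero}  f = []
sumP {suc n} f = f Fz +P sumP (λ j → f (Fs j))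


sign : ℕ → Poly
sign zero          = cst 1ℚ
sign (suc zero)    = cst (ℤ→ℚ (ℤ.- (+ 1)))
sign (suc (suc k)) = sign k

det : ∀ n → (Fin n → Fin n → Poly) → Poly
det zero    M = cst 1ℚ
det (suc n) M = sumP λ j →
  sign (toℕ j) *P M Fz j *P det n (λ i k → M (Fs i) (punchIn j k))


-- The matrix B (indices i, j ∈ {1..n} are encoded as Fin n via
-- i = toℕ i' + 1).

B-entry : (n s i j : ℕ) → Poly
B-entry n s i j with i ℕ.≟ suc s
... | no _ =
  poch (cst (ℤ→ℚ (+ (n ℕ.+ 2 ℕ.+ j) ℤ.- + (2 ℕ.* i)))) (n ∸ j)
  *P poch (X +P cst (ℤ→ℚ (+ (i ℕ.+ 1) ℤ.- + j))) (j ∸ 1)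
  *P (X +P cst ((ℤ→ℚ (+ (n ℕ.+ 1) ℤ.- + j)) ℚ.* (+ 1 / 2)))
... | yes _ =
  poch (cst (ℤ→ℚ (+ (n ℕ.+ 1 ℕ.+ j) ℤ.- + (2 ℕ.* s)))) (n ∸ j)
  *P poch (X +P cst (ℤ→ℚ (+ (s ℕ.+ 1) ℤ.- + j))) (j ∸ 1)

B : (n s : ℕ) → Fin n → Fin n → Poly
B n s i j = B-entry n s (suc (toℕ i)) (suc (toℕ j))

h : ℕ → ℕ
h zero    = 1
h (suc n) = h n ℕ.* (n !)

-- oddFact k = (2k-1)!! = 1·3···(2k-1), oddFact 0 = (-1)!! = 1
oddFact : ℕ → ℕ
oddFact zero    = 1
oddFact (suc k) = (2 ℕ.* k ℕ.+ 1) ℕ.* oddFact k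

rhs : ℕ → ℕ → ℚ
rhs n s =
  (+ (2 ℕ.^ ((n ∸ 1) C 2) ℕ.* h n ℕ.* oddFact (n ∸ s) ℕ.* oddFact s))
    / ((n ∸ s ∸ 1) ! ℕ.* s !)
  where instance _ = (n ∸ s ∸ 1) !* s !≢0

{-# OPTIONS --safe #-}

-- Row i of B has degree at most [i ≠ s + 1] + (j - 1) in column j, so the coefficient of the
-- matching power of m in det B is the determinant of the top coefficients (x_i + j)_{n-j},
-- where x_i = n + 2 - 2i and x_{s+1} = n + 1 - 2s.  Adding to every column a multiple of the
-- next one reduces this Pochhammer matrix to a Vandermonde determinant ∏_{i<j} (x_i - x_j).
-- All differences are 2(j - i), except the odd ones involving the exceptional node x_{s+1};
-- they produce the double factorials.  The value is nonzero, so it is the leading coefficient.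

module Submission where

open import Defs
open import Algebra.Bundles using (CommutativeRing; CommutativeMonoid)
open import Data.Nat as ℕ using (ℕ; zero; suc; z≤n; s≤s; _∸_; _!; _≤_; _<_)
import Data.Nat.Properties as ℕP
open import Data.Nat.Combinatorics using (_C_; nC1≡n; nCk+nC[k+1]≡[n+1]C[k+1])
open import Data.Integer as ℤ using (ℤ; +_)
import Data.Integer.Properties as ℤP
open import Data.Integer.GCD using (gcd)
open import Data.Rational as ℚ using (ℚ; 0ℚ; 1ℚ; toℚᵘ)
import Data.Rational.Properties as ℚP
open import Data.Rational.Unnormalised as ℚᵘ using (mkℚᵘ; *≡*)
import Data.Rational.Unnormalised.Properties as ℚᵘP
open import Data.List using ([]; _∷_; map)
open import Data.Fin using (Fin; zero; suc; toℕ; punchIn; punchOut; inject₁; fromℕ; fromℕ<)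
open import Data.Vec.Functional using (updateAt; insertAt)
open import Data.Vec.Functional.Properties using (updateAt-updates; updateAt-minimal; insertAt-lookup; insertAt-punchIn)
import Data.Fin.Properties as FinP
open import Algebra.Properties.Semiring.Sum (CommutativeRing.semiring ℚP.+-*-commutativeRing)
  using (sum; sum-remove; sum-cong-≗; ∑-distrib-+; *-distribˡ-sum; sum-replicate-zero)
import Algebra.Properties.CommutativeMonoid.Sum ℕP.+-0-commutativeMonoid as ℕΣ
open import Algebra.Properties.CommutativeMonoid.Sum ℚP.*-1-commutativeMonoid
  using () renaming (sum to ∏; sum-cong-≗ to ∏-cong-≗)
open import Algebra.Properties.CommutativeSemigroup (CommutativeMonoid.commutativeSemigroup ℚP.*-1-commutativeMonoid)
  using () renaming (interchange to ℚ-*-interchange)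
open import Algebra.Properties.CommutativeSemigroup ℕP.+-commutativeSemigroup
  using () renaming (interchange to ℕ-+-interchange)
import Data.Nat.Solver as ℕSolver
import Data.Integer.Solver as ℤSolver
import Data.Rational.Solver as ℚSolver
open import Data.Product using (Σ-syntax; _×_; _,_)
open import Data.Empty using (⊥-elim)
open import Function using (_∘_)
open import Relation.Binary.Definitions using (tri<; tri≈; tri>)
open import Relation.Binary.PropositionalEquality
open import Relation.Nullary using (¬_; yes; no)

toℚᵘ-ℤ→ℚ : ∀ a → toℚᵘ (ℤ→ℚ a) ℚᵘ.≃ mkℚᵘ a 0
toℚᵘ-ℤ→ℚ a = ℚP.toℚᵘ-fromℚᵘ (mkℚᵘ a 0)

ℤ→ℚ-+ : ∀ a b → ℤ→ℚ (a ℤ.+ b) ≡ ℤ→ℚ a ℚ.+ ℤ→ℚ b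
ℤ→ℚ-+ a b = ℚP.toℚᵘ-injective (begin
  toℚᵘ (ℤ→ℚ (a ℤ.+ b))             ≈⟨ toℚᵘ-ℤ→ℚ (a ℤ.+ b) ⟩
  mkℚᵘ (a ℤ.+ b) 0                  ≈⟨ *≡* (cong (ℤ._* + 1) (sym (cong₂ ℤ._+_ (ℤP.*-identityʳ a) (ℤP.*-identityʳ b)))) ⟩
  mkℚᵘ a 0 ℚᵘ.+ mkℚᵘ b 0           ≈⟨ ℚᵘP.+-cong (toℚᵘ-ℤ→ℚ a) (toℚᵘ-ℤ→ℚ b) ⟨
  toℚᵘ (ℤ→ℚ a) ℚᵘ.+ toℚᵘ (ℤ→ℚ b)  ≈⟨ ℚP.toℚᵘ-homo-+ (ℤ→ℚ a) (ℤ→ℚ b) ⟨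
  toℚᵘ (ℤ→ℚ a ℚ.+ ℤ→ℚ b)           ∎)
  where open ℚᵘP.≃-Reasoning

ℤ→ℚ-* : ∀ a b → ℤ→ℚ (a ℤ.* b) ≡ ℤ→ℚ a ℚ.* ℤ→ℚ b
ℤ→ℚ-* a b = ℚP.toℚᵘ-injective (begin
  toℚᵘ (ℤ→ℚ (a ℤ.* b))             ≈⟨ toℚᵘ-ℤ→ℚ (a ℤ.* b) ⟩
  mkℚᵘ a 0 ℚᵘ.* mkℚᵘ b 0           ≈⟨ ℚᵘP.*-cong (toℚᵘ-ℤ→ℚ a) (toℚᵘ-ℤ→ℚ b) ⟨
  toℚᵘ (ℤ→ℚ a) ℚᵘ.* toℚᵘ (ℤ→ℚ b)  ≈⟨ ℚP.toℚᵘ-homo-* (ℤ→ℚ a) (ℤ→ℚ b) ⟨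
  toℚᵘ (ℤ→ℚ a ℚ.* ℤ→ℚ b)           ∎)
  where open ℚᵘP.≃-Reasoning

ℤ→ℚ-- : ∀ a b → ℤ→ℚ (a ℤ.- b) ≡ ℤ→ℚ a ℚ.- ℤ→ℚ b
ℤ→ℚ-- a b = trans (ℤ→ℚ-+ a (ℤ.- b)) (cong (ℤ→ℚ a ℚ.+_) (ℚP.toℚᵘ-injective (begin
  toℚᵘ (ℤ→ℚ (ℤ.- b))     ≈⟨ toℚᵘ-ℤ→ℚ (ℤ.- b) ⟩
  ℚᵘ.- mkℚᵘ b 0          ≈⟨ ℚᵘP.-‿cong (toℚᵘ-ℤ→ℚ b) ⟨
  ℚᵘ.- toℚᵘ (ℤ→ℚ b)      ≈⟨ ℚP.toℚᵘ-homo‿- (ℤ→ℚ b) ⟨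
  toℚᵘ (ℚ.- ℤ→ℚ b)       ∎)))
  where open ℚᵘP.≃-Reasoning

ℕ→ℚ-suc : ∀ k → ℕ→ℚ (suc k) ≡ 1ℚ ℚ.+ ℕ→ℚ k
ℕ→ℚ-suc k = ℤ→ℚ-+ (+ 1) (+ k)

ℕ→ℚ-* : ∀ m n → ℕ→ℚ (m ℕ.* n) ≡ ℕ→ℚ m ℚ.* ℕ→ℚ n
ℕ→ℚ-* m n = trans (cong ℤ→ℚ (ℤP.pos-* m n)) (ℤ→ℚ-* (+ m) (+ n))

q*d≡m⇒q≡m/d : ∀ q m d .{{_ : ℕ.NonZero d}} → q ℚ.* ℕ→ℚ d ≡ ℕ→ℚ m → q ≡ + m ℚ./ d
q*d≡m⇒q≡m/d q@(ℚ.mkℚ a e _) m (suc d) eq =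
  ℚP.toℚᵘ-injective (ℚᵘP.≃-trans cross (ℚᵘP.≃-sym (ℚP.toℚᵘ-fromℚᵘ (mkℚᵘ (+ m) d))))
  where
  open ℚᵘP.≃-Reasoning
  product : mkℚᵘ a e ℚᵘ.* mkℚᵘ (+ suc d) 0 ℚᵘ.≃ mkℚᵘ (+ m) 0
  product = begin
    mkℚᵘ a e ℚᵘ.* mkℚᵘ (+ suc d) 0     ≈⟨ ℚᵘP.*-congˡ {mkℚᵘ a e} (toℚᵘ-ℤ→ℚ (+ suc d)) ⟨
    toℚᵘ q ℚᵘ.* toℚᵘ (ℕ→ℚ (suc d))    ≈⟨ ℚP.toℚᵘ-homo-* q (ℕ→ℚ (suc d)) ⟨
    toℚᵘ (q ℚ.* ℕ→ℚ (suc d))          ≈⟨ ℚP.toℚᵘ-cong eq ⟩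
    toℚᵘ (ℕ→ℚ m)                       ≈⟨ toℚᵘ-ℤ→ℚ (+ m) ⟩
    mkℚᵘ (+ m) 0                       ∎
  cross : mkℚᵘ a e ℚᵘ.≃ mkℚᵘ (+ m) d
  cross with *≡* a*d≡m*e ← product =
    *≡* (trans (sym (ℤP.*-identityʳ _)) (trans a*d≡m*e (cong (λ k → + m ℤ.* + k) (ℕP.*-identityʳ (suc e)))))

m/d≢0 : ∀ m d .{{_ : ℕ.NonZero m}} .{{_ : ℕ.NonZero d}} → ¬ (+ m ℚ./ d ≡ 0ℚ)
m/d≢0 m d eq = ℕ.≢-nonZero⁻¹ m (ℤP.+-injective (begin
  + m                                  ≡⟨ ℚP.↥-/ (+ m) d ⟨
  ℚ.↥ (+ m ℚ./ d) ℤ.* gcd (+ m) (+ d)  ≡⟨ cong (λ q → ℚ.↥ q ℤ.* gcd (+ m) (+ d)) eq ⟩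
  + 0 ℤ.* gcd (+ m) (+ d)              ≡⟨ ℤP.*-zeroˡ (gcd (+ m) (+ d)) ⟩
  + 0                                  ∎))
  where open ≡-Reasoning

-- Top coefficients of polynomials

coeff : Poly → ℕ → ℚ
coeff []      _       = 0ℚ
coeff (a ∷ p) zero    = a
coeff (a ∷ p) (suc k) = coeff p k

coeff-+P : ∀ p q k → coeff (p +P q) k ≡ coeff p k ℚ.+ coeff q k
coeff-+P []      q       k       = sym (ℚP.+-identityˡ _)
coeff-+P (a ∷ p) []      k       = sym (ℚP.+-identityʳ _)
coeff-+P (a ∷ p) (b ∷ q) zero    = refl
coeff-+P (a ∷ p) (b ∷ q) (suc k) = coeff-+P p q k

coeff-scale : ∀ a q k → coeff (map (a ℚ.*_) q) k ≡ a ℚ.* coeff q k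
coeff-scale a []      k       = sym (ℚP.*-zeroʳ a)
coeff-scale a (b ∷ q) zero    = refl
coeff-scale a (b ∷ q) (suc k) = coeff-scale a q k

Vanishing : Poly → Set
Vanishing p = ∀ k → coeff p k ≡ 0ℚ

-- a may be 0, in which case only the degree bound is asserted.
record TopCoeff (p : Poly) (d : ℕ) (a : ℚ) : Set where
  constructor top
  field
    coeff-top   : coeff p d ≡ a
    coeff-above : ∀ {k} → d < k → coeff p k ≡ 0ℚ
open TopCoeff

vanishing⇒top : ∀ {p} d → Vanishing p → TopCoeff p d 0ℚ
vanishing⇒top d z = top (z d) (λ {k} _ → z k)

top-raise : ∀ {p d e a} → TopCoeff p d a → d < e → TopCoeff p e 0ℚ
top-raise t d<e = top (coeff-above t d<e) (λ e<k → coeff-above t (ℕP.<-trans d<e e<k))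

top-cst : ∀ c → TopCoeff (cst c) 0 c
top-cst c = top refl λ { {suc k} _ → refl }

top-+P : ∀ {p q d a b} → TopCoeff p d a → TopCoeff q d b → TopCoeff (p +P q) d (a ℚ.+ b)
top-+P {p} {q} {d} tp tq = top
  (trans (coeff-+P p q d) (cong₂ ℚ._+_ (coeff-top tp) (coeff-top tq)))
  (λ {k} d<k → trans (coeff-+P p q k) (cong₂ ℚ._+_ (coeff-above tp d<k) (coeff-above tq d<k)))

top-scale : ∀ {q e b} a → TopCoeff q e b → TopCoeff (map (a ℚ.*_) q) e (a ℚ.* b)
top-scale {q} {e} a t = top
  (trans (coeff-scale a q e) (cong (a ℚ.*_) (coeff-top t)))
  (λ {k} e<k → trans (coeff-scale a q k) (trans (cong (a ℚ.*_) (coeff-above t e<k)) (ℚP.*-zeroʳ a)))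

top-reindex : ∀ {p d e a} → d ≡ e → TopCoeff p d a → TopCoeff p e a
top-reindex refl t = t

top-tail : ∀ {a p d c} → TopCoeff (a ∷ p) (suc d) c → TopCoeff p d c
top-tail t = top (coeff-top t) (coeff-above t ∘ s≤s)

top-shift : ∀ {p d a} → TopCoeff p d a → TopCoeff (0ℚ ∷ p) (suc d) a
top-shift t = top (coeff-top t) λ { {suc k} (s≤s d<k) → coeff-above t d<k }

vanishing-shift : ∀ {p} → Vanishing p → Vanishing (0ℚ ∷ p)
vanishing-shift z zero    = refl
vanishing-shift z (suc k) = z k

vanishing-*P : ∀ p q → Vanishing p → Vanishing (p *P q)
vanishing-*P []      q z k = refl
vanishing-*P (a ∷ p) q z k = begin
  coeff (map (a ℚ.*_) q +P (0ℚ ∷ p *P q)) k            ≡⟨ coeff-+P (map (a ℚ.*_) q) _ k ⟩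
  coeff (map (a ℚ.*_) q) k ℚ.+ coeff (0ℚ ∷ p *P q) k   ≡⟨ cong₂ ℚ._+_ (coeff-scale a q k) (shifted k) ⟩
  a ℚ.* coeff q k ℚ.+ 0ℚ                              ≡⟨ cong (λ x → x ℚ.* coeff q k ℚ.+ 0ℚ) (z 0) ⟩
  0ℚ ℚ.* coeff q k ℚ.+ 0ℚ                             ≡⟨ cong (ℚ._+ 0ℚ) (ℚP.*-zeroˡ (coeff q k)) ⟩
  0ℚ                                                  ∎
  where
  open ≡-Reasoning
  shifted : Vanishing (0ℚ ∷ p *P q)
  shifted = vanishing-shift (vanishing-*P p q (z ∘ suc))

top-*P : ∀ {p q d e a b} → TopCoeff p d a → TopCoeff q e b → TopCoeff (p *P q) (d ℕ.+ e) (a ℚ.* b)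
top-*P {[]} {d = d} {e} {a} {b} tp _ =
  subst (TopCoeff [] (d ℕ.+ e)) (trans (sym (ℚP.*-zeroˡ b)) (cong (ℚ._* b) (coeff-top tp)))
        (vanishing⇒top (d ℕ.+ e) λ _ → refl)
top-*P {a₀ ∷ p} {q} {zero} {e} {b = b} tp tq =
  subst (TopCoeff _ e) (trans (ℚP.+-identityʳ (a₀ ℚ.* b)) (cong (ℚ._* b) (coeff-top tp)))
        (top-+P (top-scale a₀ tq) (vanishing⇒top e (vanishing-shift (vanishing-*P p q (λ k → coeff-above tp (s≤s z≤n))))))
top-*P {a₀ ∷ p} {d = suc d} {e} tp tq =
  subst (TopCoeff _ _) (ℚP.+-identityˡ _)
        (top-+P (top-raise (top-scale a₀ tq) (s≤s (ℕP.m≤n+m e d))) (top-shift (top-*P (top-tail tp) tq)))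

leadCoeff-vanishing : ∀ p → Vanishing p → leadCoeff p ≡ 0ℚ
leadCoeff-vanishing []      z = refl
leadCoeff-vanishing (a ∷ p) z with leadCoeff p ℚP.≟ 0ℚ
... | yes _  = z 0
... | no ≢0 = ⊥-elim (≢0 (leadCoeff-vanishing p (z ∘ suc)))

leadCoeff-top : ∀ {p d a} → TopCoeff p d a → ¬ a ≡ 0ℚ → leadCoeff p ≡ a
leadCoeff-top {[]}             t a≢0 = ⊥-elim (a≢0 (sym (coeff-top t)))
leadCoeff-top {a₀ ∷ p} {zero}  t a≢0 with leadCoeff p ℚP.≟ 0ℚ
... | yes _  = coeff-top t
... | no ≢0 = ⊥-elim (≢0 (leadCoeff-vanishing p (λ k → coeff-above t (s≤s z≤n))))
leadCoeff-top {a₀ ∷ p} {suc d} t a≢0 with leadCoeff p ℚP.≟ 0ℚ | leadCoeff-top (top-tail t) a≢0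
... | yes ≡0 | ≡a = ⊥-elim (a≢0 (trans (sym ≡a) ≡0))
... | no _   | ≡a = ≡a

pochℚ : ℚ → ℕ → ℚ
pochℚ c zero    = 1ℚ
pochℚ c (suc k) = pochℚ c k ℚ.* (c ℚ.+ ℕ→ℚ k)

top-poch-cst : ∀ c k → TopCoeff (poch (cst c) k) 0 (pochℚ c k)
top-poch-cst c zero    = top-cst 1ℚ
top-poch-cst c (suc k) = top-*P (top-poch-cst c k) (top-cst (c ℚ.+ ℕ→ℚ k))

top-monic-linear : ∀ a → TopCoeff (a ∷ 1ℚ ∷ []) 1 1ℚ
top-monic-linear a = top refl λ { {suc zero} (s≤s ()) ; {suc (suc k)} _ → refl }

top-poch-X : ∀ c k → TopCoeff (poch (X +P cst c) k) k 1ℚ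
top-poch-X c zero    = top-cst 1ℚ
top-poch-X c (suc k) =
  top-reindex (ℕP.+-comm k 1) (top-*P (top-poch-X c k) (top-monic-linear _))

-- Determinants over ℚ

Matrix : ℕ → Set
Matrix n = Fin n → Fin n → ℚ

minor : ∀ {n} → Matrix (suc n) → Fin (suc n) → Matrix n
minor M j i k = M (suc i) (punchIn j k)

signℚ : ℕ → ℚ
signℚ zero          = 1ℚ
signℚ (suc zero)    = ℤ→ℚ (ℤ.- + 1)
signℚ (suc (suc k)) = signℚ k

detℚ : ∀ {n} → Matrix n → ℚ
laplaceTerm : ∀ {n} → Matrix (suc n) → Fin (suc n) → ℚ

detℚ {zero}  M = 1ℚ
detℚ {suc n} M = sum (laplaceTerm M)

laplaceTerm M j = signℚ (toℕ j) ℚ.* M zero j ℚ.* detℚ (minor M j)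

top-sign : ∀ k → TopCoeff (sign k) 0 (signℚ k)
top-sign zero          = top-cst 1ℚ
top-sign (suc zero)    = top-cst _
top-sign (suc (suc k)) = top-sign k

top-sumP : ∀ {n} {f : Fin n → Poly} {d} {c : Fin n → ℚ} → (∀ j → TopCoeff (f j) d (c j)) → TopCoeff (sumP f) d (sum c)
top-sumP {zero}  {d = d} t = vanishing⇒top d λ _ → refl
top-sumP {suc n}         t = top-+P (t zero) (top-sumP (t ∘ suc))

top-det : ∀ n {M : Fin n → Fin n → Poly} {r c : Fin n → ℕ} {C : Matrix n} →
          (∀ i j → TopCoeff (M i j) (r i ℕ.+ c j) (C i j)) →
          TopCoeff (det n M) (ℕΣ.sum r ℕ.+ ℕΣ.sum c) (detℚ C)
top-det zero          t = top-cst 1ℚ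
top-det (suc n) {r = r} {c} t = top-sumP λ j →
  top-reindex (degree j)
    (top-*P (top-*P (top-sign (toℕ j)) (t zero j)) (top-det n λ i k → t (suc i) (punchIn j k)))
  where
  degree : ∀ j → (r zero ℕ.+ c j) ℕ.+ (ℕΣ.sum (r ∘ suc) ℕ.+ ℕΣ.sum (c ∘ punchIn j)) ≡ ℕΣ.sum r ℕ.+ ℕΣ.sum c
  degree j = trans (ℕ-+-interchange (r zero) (c j) (ℕΣ.sum (r ∘ suc)) (ℕΣ.sum (c ∘ punchIn j)))
                   (cong (ℕΣ.sum r ℕ.+_) (sym (ℕΣ.sum-remove c)))

*-zero-middle : ∀ a b → a ℚ.* 0ℚ ℚ.* b ≡ 0ℚ
*-zero-middle a b = trans (cong (ℚ._* b) (ℚP.*-zeroʳ a)) (ℚP.*-zeroˡ b)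

detℚ-cong : ∀ {n} {M N : Matrix n} → (∀ i j → M i j ≡ N i j) → detℚ M ≡ detℚ N
detℚ-cong {zero}  eq = refl
detℚ-cong {suc n} eq = sum-cong-≗ λ j →
  cong₂ (λ x y → signℚ (toℕ j) ℚ.* x ℚ.* y) (eq zero j) (detℚ-cong λ i k → eq (suc i) (punchIn j k))

detℚ-scale-rows : ∀ {n} (r : Fin n → ℚ) (M : Matrix n) → detℚ (λ i j → r i ℚ.* M i j) ≡ ∏ r ℚ.* detℚ M
detℚ-scale-rows {zero}  r M = sym (ℚP.*-identityˡ 1ℚ)
detℚ-scale-rows {suc n} r M = begin
  sum (λ j → signℚ (toℕ j) ℚ.* (r zero ℚ.* M zero j) ℚ.* detℚ (λ i k → r (suc i) ℚ.* minor M j i k))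
    ≡⟨ sum-cong-≗ (λ j → cong (signℚ (toℕ j) ℚ.* (r zero ℚ.* M zero j) ℚ.*_) (detℚ-scale-rows (r ∘ suc) (minor M j))) ⟩
  sum (λ j → signℚ (toℕ j) ℚ.* (r zero ℚ.* M zero j) ℚ.* (∏ (r ∘ suc) ℚ.* detℚ (minor M j)))
    ≡⟨ sum-cong-≗ (λ j → regroup (signℚ (toℕ j)) (r zero) (M zero j) (∏ (r ∘ suc)) (detℚ (minor M j))) ⟩
  sum (λ j → ∏ r ℚ.* laplaceTerm M j)
    ≡⟨ *-distribˡ-sum (∏ r) (laplaceTerm M) ⟨
  ∏ r ℚ.* detℚ M
    ∎
  where
  open ≡-Reasoning
  open ℚSolver.+-*-Solver
  regroup : ∀ s a m p d → s ℚ.* (a ℚ.* m) ℚ.* (p ℚ.* d) ≡ (a ℚ.* p) ℚ.* (s ℚ.* m ℚ.* d)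
  regroup = solve 5 (λ s a m p d → s :* (a :* m) :* (p :* d) := (a :* p) :* (s :* m :* d)) refl

detℚ-expand-single : ∀ {n} (M : Matrix (suc n)) c → (∀ k → M zero (punchIn c k) ≡ 0ℚ) →
                     detℚ M ≡ signℚ (toℕ c) ℚ.* M zero c ℚ.* detℚ (minor M c)
detℚ-expand-single {n} M c zeros = begin
  detℚ M                       ≡⟨ sum-remove {i = c} t ⟩
  t c ℚ.+ sum (t ∘ punchIn c)  ≡⟨ cong (t c ℚ.+_) (trans (sum-cong-≗ vanish) (sum-replicate-zero n)) ⟩
  t c ℚ.+ 0ℚ                   ≡⟨ ℚP.+-identityʳ (t c) ⟩
  t c                          ∎
  where
  open ≡-Reasoning
  t : Fin (suc n) → ℚ
  t = laplaceTerm M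
  vanish : ∀ k → t (punchIn c k) ≡ 0ℚ
  vanish k = trans (cong (λ x → signℚ (toℕ (punchIn c k)) ℚ.* x ℚ.* detℚ (minor M (punchIn c k))) (zeros k))
                   (*-zero-middle (signℚ (toℕ (punchIn c k))) (detℚ (minor M (punchIn c k))))

detℚ-linear-column : ∀ {n} (c : Fin n) (a : ℚ) {M N P : Matrix n} →
                     (∀ i j → j ≢ c → M i j ≡ N i j) → (∀ i j → j ≢ c → M i j ≡ P i j) →
                     (∀ i → M i c ≡ N i c ℚ.+ a ℚ.* P i c) →
                     detℚ M ≡ detℚ N ℚ.+ a ℚ.* detℚ P
detℚ-linear-column {suc n} c a {M} {N} {P} M≡N M≡P M≡N+aP = begin
  sum (laplaceTerm M)
    ≡⟨ sum-cong-≗ split ⟩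
  sum (λ j → laplaceTerm N j ℚ.+ a ℚ.* laplaceTerm P j)
    ≡⟨ ∑-distrib-+ (laplaceTerm N) (λ j → a ℚ.* laplaceTerm P j) ⟩
  sum (laplaceTerm N) ℚ.+ sum (λ j → a ℚ.* laplaceTerm P j)
    ≡⟨ cong (sum (laplaceTerm N) ℚ.+_) (*-distribˡ-sum a (laplaceTerm P)) ⟨
  sum (laplaceTerm N) ℚ.+ a ℚ.* sum (laplaceTerm P)
    ∎
  where
  open ≡-Reasoning
  open ℚSolver.+-*-Solver
  linear-entry : ∀ s x y d → s ℚ.* (x ℚ.+ a ℚ.* y) ℚ.* d ≡ s ℚ.* x ℚ.* d ℚ.+ a ℚ.* (s ℚ.* y ℚ.* d)
  linear-entry s x y d =
    solve 5 (λ s x y d a → s :* (x :+ a :* y) :* d := s :* x :* d :+ a :* (s :* y :* d)) refl s x y d a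
  linear-minor : ∀ s x d e → s ℚ.* x ℚ.* (d ℚ.+ a ℚ.* e) ≡ s ℚ.* x ℚ.* d ℚ.+ a ℚ.* (s ℚ.* x ℚ.* e)
  linear-minor s x d e =
    solve 5 (λ s x d e a → s :* x :* (d :+ a :* e) := s :* x :* d :+ a :* (s :* x :* e)) refl s x d e a
  split : ∀ j → laplaceTerm M j ≡ laplaceTerm N j ℚ.+ a ℚ.* laplaceTerm P j
  split j with j FinP.≟ c
  ... | yes refl = begin
    signℚ (toℕ j) ℚ.* M zero j ℚ.* detℚ (minor M j)
      ≡⟨ cong (λ x → signℚ (toℕ j) ℚ.* x ℚ.* detℚ (minor M j)) (M≡N+aP zero) ⟩
    signℚ (toℕ j) ℚ.* (N zero j ℚ.+ a ℚ.* P zero j) ℚ.* detℚ (minor M j)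
      ≡⟨ linear-entry (signℚ (toℕ j)) (N zero j) (P zero j) (detℚ (minor M j)) ⟩
    signℚ (toℕ j) ℚ.* N zero j ℚ.* detℚ (minor M j) ℚ.+ a ℚ.* (signℚ (toℕ j) ℚ.* P zero j ℚ.* detℚ (minor M j))
      ≡⟨ cong₂ (λ d e → signℚ (toℕ j) ℚ.* N zero j ℚ.* d ℚ.+ a ℚ.* (signℚ (toℕ j) ℚ.* P zero j ℚ.* e))
               (detℚ-cong λ i k → M≡N (suc i) (punchIn j k) (FinP.punchInᵢ≢i j k))
               (detℚ-cong λ i k → M≡P (suc i) (punchIn j k) (FinP.punchInᵢ≢i j k)) ⟩
    laplaceTerm N j ℚ.+ a ℚ.* laplaceTerm P j ∎
  ... | no j≢c = begin
    signℚ (toℕ j) ℚ.* M zero j ℚ.* detℚ (minor M j)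
      ≡⟨ cong (signℚ (toℕ j) ℚ.* M zero j ℚ.*_) (detℚ-linear-column c′ a M≡N′ M≡P′ M≡N+aP′) ⟩
    signℚ (toℕ j) ℚ.* M zero j ℚ.* (detℚ (minor N j) ℚ.+ a ℚ.* detℚ (minor P j))
      ≡⟨ linear-minor (signℚ (toℕ j)) (M zero j) (detℚ (minor N j)) (detℚ (minor P j)) ⟩
    signℚ (toℕ j) ℚ.* M zero j ℚ.* detℚ (minor N j) ℚ.+ a ℚ.* (signℚ (toℕ j) ℚ.* M zero j ℚ.* detℚ (minor P j))
      ≡⟨ cong₂ (λ x y → signℚ (toℕ j) ℚ.* x ℚ.* detℚ (minor N j)
                         ℚ.+ a ℚ.* (signℚ (toℕ j) ℚ.* y ℚ.* detℚ (minor P j)))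
               (M≡N zero j j≢c) (M≡P zero j j≢c) ⟩
    laplaceTerm N j ℚ.+ a ℚ.* laplaceTerm P j ∎
    where
    c′ : Fin n
    c′ = punchOut j≢c
    punchIn-c′ : punchIn j c′ ≡ c
    punchIn-c′ = FinP.punchIn-punchOut j≢c
    off : ∀ k → k ≢ c′ → punchIn j k ≢ c
    off k k≢c′ eq = k≢c′ (FinP.punchIn-injective j k c′ (trans eq (sym punchIn-c′)))
    M≡N′ : ∀ i k → k ≢ c′ → minor M j i k ≡ minor N j i k
    M≡N′ i k k≢c′ = M≡N (suc i) (punchIn j k) (off k k≢c′)
    M≡P′ : ∀ i k → k ≢ c′ → minor M j i k ≡ minor P j i k
    M≡P′ i k k≢c′ = M≡P (suc i) (punchIn j k) (off k k≢c′)
    M≡N+aP′ : ∀ i → minor M j i c′ ≡ minor N j i c′ ℚ.+ a ℚ.* minor P j i c′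
    M≡N+aP′ i rewrite punchIn-c′ = M≡N+aP (suc i)

punchIn-inject₁-self : ∀ {n} (c : Fin n) → punchIn (inject₁ c) c ≡ suc c
punchIn-inject₁-self zero    = refl
punchIn-inject₁-self (suc c) = cong suc (punchIn-inject₁-self c)

punchIn-adjacent-≗ : ∀ {n} {A : Set} (g : Fin (suc n) → A) (c : Fin n) → g (inject₁ c) ≡ g (suc c) →
                     ∀ k → g (punchIn (inject₁ c) k) ≡ g (punchIn (suc c) k)
punchIn-adjacent-≗ g zero    eq zero    = sym eq
punchIn-adjacent-≗ g zero    eq (suc k) = refl
punchIn-adjacent-≗ g (suc c) eq zero    = refl
punchIn-adjacent-≗ g (suc c) eq (suc k) = punchIn-adjacent-≗ (g ∘ suc) c eq k

punchOut-adjacent : ∀ {n} (j : Fin (suc (suc n))) (c : Fin (suc n)) → j ≢ inject₁ c → j ≢ suc c →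
                    Σ[ c′ ∈ Fin n ] punchIn j (inject₁ c′) ≡ inject₁ c × punchIn j (suc c′) ≡ suc c
punchOut-adjacent         zero          zero    j≢c _    = ⊥-elim (j≢c refl)
punchOut-adjacent         zero          (suc c) _   _    = c , refl , refl
punchOut-adjacent         (suc zero)    zero    _   j≢c₁ = ⊥-elim (j≢c₁ refl)
punchOut-adjacent {suc n} (suc (suc j)) zero    _   _    = zero , refl , refl
punchOut-adjacent {suc n} (suc j)       (suc c) j≢c j≢c₁
  with c′ , eq , eq₁ ← punchOut-adjacent j c (j≢c ∘ cong suc) (j≢c₁ ∘ cong suc)
  = suc c′ , cong suc eq , cong suc eq₁

signℚ-suc : ∀ k → signℚ (suc k) ≡ ℚ.- signℚ k
signℚ-suc zero          = refl
signℚ-suc (suc zero)    = refl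
signℚ-suc (suc (suc k)) = signℚ-suc k

detℚ-adjacent-equal-columns : ∀ {n} (M : Matrix (suc n)) (c : Fin n) →
                              (∀ i → M i (inject₁ c) ≡ M i (suc c)) → detℚ M ≡ 0ℚ
detℚ-adjacent-equal-columns {suc n} M c eq = begin
  sum t                                                     ≡⟨ sum-remove {i = c₀} t ⟩
  t c₀ ℚ.+ sum (t ∘ punchIn c₀)                             ≡⟨ cong (t c₀ ℚ.+_) (sum-remove {i = c} (t ∘ punchIn c₀)) ⟩
  t c₀ ℚ.+ (t (punchIn c₀ c) ℚ.+ sum (t ∘ punchIn c₀ ∘ punchIn c))
    ≡⟨ cong₂ (λ x y → t c₀ ℚ.+ (t x ℚ.+ y)) (punchIn-inject₁-self c) (trans (sum-cong-≗ others) (sum-replicate-zero n)) ⟩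
  t c₀ ℚ.+ (t c₁ ℚ.+ 0ℚ)                                    ≡⟨ cong (t c₀ ℚ.+_) (ℚP.+-identityʳ (t c₁)) ⟩
  t c₀ ℚ.+ t c₁                                             ≡⟨ cancel ⟩
  0ℚ                                                        ∎
  where
  open ≡-Reasoning
  t : Fin (suc (suc n)) → ℚ
  t = laplaceTerm M
  c₀ c₁ : Fin (suc (suc n))
  c₀ = inject₁ c
  c₁ = suc c
  others : ∀ k → t (punchIn c₀ (punchIn c k)) ≡ 0ℚ
  others k = trans (cong (signℚ (toℕ j) ℚ.* M zero j ℚ.*_) minor-vanishes) (ℚP.*-zeroʳ (signℚ (toℕ j) ℚ.* M zero j))
    where
    j : Fin (suc (suc n))
    j = punchIn c₀ (punchIn c k)
    j≢c₁ : j ≢ c₁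
    j≢c₁ eq′ = FinP.punchInᵢ≢i c k (FinP.punchIn-injective c₀ _ _ (trans eq′ (sym (punchIn-inject₁-self c))))
    minor-vanishes : detℚ (minor M j) ≡ 0ℚ
    minor-vanishes with c′ , at-c₀ , at-c₁ ← punchOut-adjacent j c (FinP.punchInᵢ≢i c₀ _) j≢c₁ =
      detℚ-adjacent-equal-columns (minor M j) c′ λ i →
        trans (cong (M (suc i)) at-c₀) (trans (eq (suc i)) (cong (M (suc i)) (sym at-c₁)))
  cancel : t c₀ ℚ.+ t c₁ ≡ 0ℚ
  cancel = begin
    t c₀ ℚ.+ signℚ (toℕ c₁) ℚ.* M zero c₁ ℚ.* detℚ (minor M c₁)
      ≡⟨ cong₂ (λ s x → t c₀ ℚ.+ s ℚ.* x ℚ.* detℚ (minor M c₁))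
               (trans (signℚ-suc (toℕ c)) (cong (ℚ.-_ ∘ signℚ) (sym (FinP.toℕ-inject₁ c)))) (sym (eq zero)) ⟩
    t c₀ ℚ.+ ℚ.- signℚ (toℕ c₀) ℚ.* M zero c₀ ℚ.* detℚ (minor M c₁)
      ≡⟨ cong (λ d → t c₀ ℚ.+ ℚ.- signℚ (toℕ c₀) ℚ.* M zero c₀ ℚ.* d)
              (detℚ-cong λ i → punchIn-adjacent-≗ (M (suc i)) c (eq (suc i))) ⟨
    t c₀ ℚ.+ ℚ.- signℚ (toℕ c₀) ℚ.* M zero c₀ ℚ.* detℚ (minor M c₀)
      ≡⟨ solve 3 (λ s x d → s :* x :* d :+ (:- s) :* x :* d := con 0ℚ) refl (signℚ (toℕ c₀)) (M zero c₀) (detℚ (minor M c₀)) ⟩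
    0ℚ
      ∎
    where open ℚSolver.+-*-Solver

suc≢inject₁ : ∀ {n} (c : Fin n) → suc c ≢ inject₁ c
suc≢inject₁ zero    ()
suc≢inject₁ (suc c) eq = suc≢inject₁ c (FinP.suc-injective eq)

detℚ-add-next-column : ∀ {n} (c : Fin n) (a : ℚ) {M N : Matrix (suc n)} →
                       (∀ i j → j ≢ inject₁ c → N i j ≡ M i j) →
                       (∀ i → N i (inject₁ c) ≡ M i (inject₁ c) ℚ.+ a ℚ.* M i (suc c)) →
                       detℚ N ≡ detℚ M
detℚ-add-next-column {n} c a {M} {N} off on = begin
  detℚ N                        ≡⟨ detℚ-linear-column (inject₁ c) a off N≡P on′ ⟩
  detℚ M ℚ.+ a ℚ.* detℚ P       ≡⟨ cong (λ x → detℚ M ℚ.+ a ℚ.* x) (detℚ-adjacent-equal-columns P c P-repeats) ⟩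
  detℚ M ℚ.+ a ℚ.* 0ℚ           ≡⟨ cong (detℚ M ℚ.+_) (ℚP.*-zeroʳ a) ⟩
  detℚ M ℚ.+ 0ℚ                 ≡⟨ ℚP.+-identityʳ (detℚ M) ⟩
  detℚ M                        ∎
  where
  open ≡-Reasoning
  P : Matrix (suc n)
  P i = updateAt (M i) (inject₁ c) λ _ → M i (suc c)
  N≡P : ∀ i j → j ≢ inject₁ c → N i j ≡ P i j
  N≡P i j j≢c = trans (off i j j≢c) (sym (updateAt-minimal j (inject₁ c) (M i) j≢c))
  on′ : ∀ i → N i (inject₁ c) ≡ M i (inject₁ c) ℚ.+ a ℚ.* P i (inject₁ c)
  on′ i = trans (on i) (cong (λ x → M i (inject₁ c) ℚ.+ a ℚ.* x) (sym (updateAt-updates (inject₁ c) (M i))))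
  P-repeats : ∀ i → P i (inject₁ c) ≡ P i (suc c)
  P-repeats i = trans (updateAt-updates (inject₁ c) (M i)) (sym (updateAt-minimal (suc c) (inject₁ c) (M i) (suc≢inject₁ c)))

spliceColumns : ∀ {n} → ℕ → Matrix n → Matrix n → Matrix n
spliceColumns t N M i j with toℕ j ℕ.<? t
... | yes _ = N i j
... | no  _ = M i j

spliceColumns-< : ∀ {n t} {N M : Matrix n} {i j} → toℕ j < t → spliceColumns t N M i j ≡ N i j
spliceColumns-< {t = t} {j = j} j<t with toℕ j ℕ.<? t
... | yes _   = refl
... | no j≮t = ⊥-elim (j≮t j<t)

spliceColumns-≮ : ∀ {n t} {N M : Matrix n} {i j} → ¬ toℕ j < t → spliceColumns t N M i j ≡ M i j
spliceColumns-≮ {t = t} {j = j} j≮t with toℕ j ℕ.<? t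
... | yes j<t = ⊥-elim (j≮t j<t)
... | no _    = refl

-- Column t + 1 is still untouched when column t is modified, so the operations can be
-- performed one at a time from left to right.
detℚ-add-next-columns : ∀ {n} (a : Fin n → ℚ) {M N : Matrix (suc n)} →
                        (∀ i c → N i (inject₁ c) ≡ M i (inject₁ c) ℚ.+ a c ℚ.* M i (suc c)) →
                        (∀ i → N i (fromℕ n) ≡ M i (fromℕ n)) →
                        detℚ N ≡ detℚ M
detℚ-add-next-columns {n} a {M} {N} on last = begin
  detℚ N                      ≡⟨ detℚ-cong (λ i j → sym (all-columns i j)) ⟩
  detℚ (spliceColumns n N M)  ≡⟨ stages n ℕP.≤-refl ⟩
  detℚ M                      ∎
  where
  open ≡-Reasoning
  step : ∀ t → t < n → detℚ (spliceColumns (suc t) N M) ≡ detℚ (spliceColumns t N M)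
  step t t<n = detℚ-add-next-column c (a c) off on-c
    where
    c : Fin n
    c = fromℕ< t<n
    toℕ-c : toℕ (inject₁ c) ≡ t
    toℕ-c = trans (FinP.toℕ-inject₁ c) (FinP.toℕ-fromℕ< t<n)
    1+c≮t : ¬ suc (toℕ c) < t
    1+c≮t 1+c<t = ℕP.<-irrefl (FinP.toℕ-fromℕ< t<n) (ℕP.<-trans (ℕP.n<1+n _) 1+c<t)
    off : ∀ i j → j ≢ inject₁ c → spliceColumns (suc t) N M i j ≡ spliceColumns t N M i j
    off i j j≢c with ℕP.<-cmp (toℕ j) t
    ... | tri< j<t _ _   = trans (spliceColumns-< (ℕP.m<n⇒m<1+n j<t)) (sym (spliceColumns-< j<t))
    ... | tri≈ _ j≡t _   = ⊥-elim (j≢c (FinP.toℕ-injective (trans j≡t (sym toℕ-c))))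
    ... | tri> _ _ t<j   = trans (spliceColumns-≮ (ℕP.<⇒≱ t<j ∘ ℕ.s≤s⁻¹)) (sym (spliceColumns-≮ (ℕP.<-asym t<j)))
    on-c : ∀ i → spliceColumns (suc t) N M i (inject₁ c)
               ≡ spliceColumns t N M i (inject₁ c) ℚ.+ a c ℚ.* spliceColumns t N M i (suc c)
    on-c i = begin
      spliceColumns (suc t) N M i (inject₁ c)      ≡⟨ spliceColumns-< (ℕP.≤-reflexive (cong suc toℕ-c)) ⟩
      N i (inject₁ c)                              ≡⟨ on i c ⟩
      M i (inject₁ c) ℚ.+ a c ℚ.* M i (suc c)      ≡⟨ cong₂ (λ x y → x ℚ.+ a c ℚ.* y)
                                                         (sym (spliceColumns-≮ (ℕP.<-irrefl toℕ-c)))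
                                                         (sym (spliceColumns-≮ 1+c≮t)) ⟩
      spliceColumns t N M i (inject₁ c) ℚ.+ a c ℚ.* spliceColumns t N M i (suc c) ∎
  stages : ∀ t → t ≤ n → detℚ (spliceColumns t N M) ≡ detℚ M
  stages zero    _   = refl
  stages (suc t) t<n = trans (step t t<n) (stages t (ℕP.<⇒≤ t<n))
  all-columns : ∀ i j → spliceColumns n N M i j ≡ N i j
  all-columns i j with ℕP.<-cmp (toℕ j) n
  ... | tri< j<n _ _ = spliceColumns-< j<n
  ... | tri≈ _ j≡n _ = trans (spliceColumns-≮ (ℕP.<-irrefl j≡n))
                             (trans (cong (M i) j≡last) (sym (trans (cong (N i) j≡last) (last i))))
    where
    j≡last : j ≡ fromℕ n
    j≡last = FinP.toℕ-injective (trans j≡n (sym (FinP.toℕ-fromℕ n)))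
  ... | tri> _ _ n<j = ⊥-elim (ℕP.<⇒≱ n<j (ℕ.s≤s⁻¹ (FinP.toℕ<n j)))

-- The Pochhammer–Vandermonde determinant

pochℚ-suc : ∀ c k → pochℚ c (suc k) ≡ c ℚ.* pochℚ (c ℚ.+ 1ℚ) k
pochℚ-suc c zero    = solve 1 (λ c → con 1ℚ :* (c :+ con 0ℚ) := c :* con 1ℚ) refl c
  where open ℚSolver.+-*-Solver
pochℚ-suc c (suc k) = begin
  pochℚ c (suc k) ℚ.* (c ℚ.+ ℕ→ℚ (suc k))
    ≡⟨ cong₂ (λ p m → p ℚ.* (c ℚ.+ m)) (pochℚ-suc c k) (ℕ→ℚ-suc k) ⟩
  c ℚ.* pochℚ (c ℚ.+ 1ℚ) k ℚ.* (c ℚ.+ (1ℚ ℚ.+ ℕ→ℚ k))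
    ≡⟨ solve 3 (λ c p m → c :* p :* (c :+ (con 1ℚ :+ m)) := c :* (p :* ((c :+ con 1ℚ) :+ m))) refl
             c (pochℚ (c ℚ.+ 1ℚ) k) (ℕ→ℚ k) ⟩
  c ℚ.* pochℚ (c ℚ.+ 1ℚ) (suc k)
    ∎
  where
  open ≡-Reasoning
  open ℚSolver.+-*-Solver

vandermonde : ∀ n → (Fin n → ℚ) → ℚ
vandermonde zero    x = 1ℚ
vandermonde (suc n) x = ∏ (λ k → x zero ℚ.- x (suc k)) ℚ.* vandermonde n (x ∘ suc)

vandermonde-translate : ∀ n {x y : Fin n → ℚ} c → (∀ i → y i ≡ x i ℚ.+ c) → vandermonde n y ≡ vandermonde n x
vandermonde-translate zero    c y≡x+c = refl
vandermonde-translate (suc n) {x} {y} c y≡x+c =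
  cong₂ ℚ._*_ (∏-cong-≗ λ k → trans (cong₂ ℚ._-_ (y≡x+c zero) (y≡x+c (suc k)))
                                     (solve 3 (λ a b c → (a :+ c) :- (b :+ c) := a :- b) refl (x zero) (x (suc k)) c))
              (vandermonde-translate n c (y≡x+c ∘ suc))
  where open ℚSolver.+-*-Solver

∏-negate : ∀ {n} (f : Fin n → ℚ) → signℚ n ℚ.* ∏ f ≡ ∏ (ℚ.-_ ∘ f)
∏-negate {zero}  f = ℚP.*-identityˡ 1ℚ
∏-negate {suc n} f = begin
  signℚ (suc n) ℚ.* (f zero ℚ.* ∏ (f ∘ suc))
    ≡⟨ cong (ℚ._* (f zero ℚ.* ∏ (f ∘ suc))) (signℚ-suc n) ⟩
  ℚ.- signℚ n ℚ.* (f zero ℚ.* ∏ (f ∘ suc))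
    ≡⟨ solve 3 (λ s a p → (:- s) :* (a :* p) := (:- a) :* (s :* p)) refl (signℚ n) (f zero) (∏ (f ∘ suc)) ⟩
  ℚ.- f zero ℚ.* (signℚ n ℚ.* ∏ (f ∘ suc))
    ≡⟨ cong (ℚ.- f zero ℚ.*_) (∏-negate (f ∘ suc)) ⟩
  ℚ.- f zero ℚ.* ∏ (ℚ.-_ ∘ f ∘ suc)
    ∎
  where
  open ≡-Reasoning
  open ℚSolver.+-*-Solver

punchIn-fromℕ : ∀ {n} (k : Fin n) → punchIn (fromℕ n) k ≡ inject₁ k
punchIn-fromℕ zero    = refl
punchIn-fromℕ (suc k) = cong suc (punchIn-fromℕ k)

insertAt-fromℕ-inject₁ : ∀ {n} {A : Set} (xs : Fin n → A) v k → insertAt xs (fromℕ n) v (inject₁ k) ≡ xs k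
insertAt-fromℕ-inject₁ {n} xs v k = trans (cong (insertAt xs (fromℕ n) v) (sym (punchIn-fromℕ k))) (insertAt-punchIn xs (fromℕ n) v k)

pochhammerMatrix : ∀ n → (Fin n → ℚ) → Matrix n
pochhammerMatrix n x i j = pochℚ (x i ℚ.+ ℕ→ℚ (suc (toℕ j))) (n ∸ suc (toℕ j))

-- Subtracting (x₀ + j + 1) times column j + 1 from each column j leaves only the
-- entry 1 in the last column of row 0, and the factors x i - x₀ in the other rows.
detℚ-pochhammer : ∀ n (x : Fin n → ℚ) → detℚ (pochhammerMatrix n x) ≡ vandermonde n x
detℚ-pochhammer zero    x = refl
detℚ-pochhammer (suc n) x = begin
  detℚ (pochhammerMatrix (suc n) x)
    ≡⟨ detℚ-add-next-columns a {M = pochhammerMatrix (suc n) x} {N = N} reduced-column last-column ⟨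
  detℚ N
    ≡⟨ detℚ-expand-single N (fromℕ n) first-row ⟩
  signℚ (toℕ (fromℕ n)) ℚ.* N zero (fromℕ n) ℚ.* detℚ (minor N (fromℕ n))
    ≡⟨ cong₂ (λ s d → signℚ s ℚ.* N zero (fromℕ n) ℚ.* d) (FinP.toℕ-fromℕ n) (detℚ-cong minor-N) ⟩
  signℚ n ℚ.* N zero (fromℕ n) ℚ.* detℚ (λ i k → r i ℚ.* pochhammerMatrix n x′ i k)
    ≡⟨ cong₂ (λ e d → signℚ n ℚ.* e ℚ.* d) (insertAt-lookup _ (fromℕ n) 1ℚ) (detℚ-scale-rows r (pochhammerMatrix n x′)) ⟩
  signℚ n ℚ.* 1ℚ ℚ.* (∏ r ℚ.* detℚ (pochhammerMatrix n x′))
    ≡⟨ cong (λ d → signℚ n ℚ.* 1ℚ ℚ.* (∏ r ℚ.* d))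
            (trans (detℚ-pochhammer n x′) (vandermonde-translate n 1ℚ λ _ → refl)) ⟩
  signℚ n ℚ.* 1ℚ ℚ.* (∏ r ℚ.* vandermonde n (x ∘ suc))
    ≡⟨ solve 3 (λ s p v → s :* con 1ℚ :* (p :* v) := (s :* p) :* v) refl (signℚ n) (∏ r) (vandermonde n (x ∘ suc)) ⟩
  signℚ n ℚ.* ∏ r ℚ.* vandermonde n (x ∘ suc)
    ≡⟨ cong (ℚ._* vandermonde n (x ∘ suc)) (trans (∏-negate r) (∏-cong-≗ λ i → negate-difference (x (suc i)) (x zero))) ⟩
  vandermonde (suc n) x
    ∎
  where
  r : Fin n → ℚ
  r i = x (suc i) ℚ.- x zero
  open ≡-Reasoning
  open ℚSolver.+-*-Solver
  negate-difference : ∀ a b → ℚ.- (a ℚ.- b) ≡ b ℚ.- a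
  negate-difference = solve 2 (λ a b → :- (a :- b) := b :- a) refl
  Q : ℚ → ℕ → ℚ
  Q y t = pochℚ (y ℚ.+ ℕ→ℚ (suc t)) (n ∸ t)
  Q-step : ∀ y t → t < n → Q y t ≡ (y ℚ.+ ℕ→ℚ (suc t)) ℚ.* Q y (suc t)
  Q-step y t t<n = begin
    pochℚ (y ℚ.+ ℕ→ℚ (suc t)) (n ∸ t)
      ≡⟨ cong (pochℚ _) (ℕP.+-∸-assoc 1 t<n) ⟩
    pochℚ (y ℚ.+ ℕ→ℚ (suc t)) (suc (n ∸ suc t))
      ≡⟨ pochℚ-suc _ (n ∸ suc t) ⟩
    (y ℚ.+ ℕ→ℚ (suc t)) ℚ.* pochℚ (y ℚ.+ ℕ→ℚ (suc t) ℚ.+ 1ℚ) (n ∸ suc t)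
      ≡⟨ cong (λ c → (y ℚ.+ ℕ→ℚ (suc t)) ℚ.* pochℚ c (n ∸ suc t)) shift ⟩
    (y ℚ.+ ℕ→ℚ (suc t)) ℚ.* Q y (suc t)
      ∎
    where
    shift : y ℚ.+ ℕ→ℚ (suc t) ℚ.+ 1ℚ ≡ y ℚ.+ ℕ→ℚ (suc (suc t))
    shift = trans (solve 3 (λ y s o → y :+ s :+ o := y :+ (o :+ s)) refl y (ℕ→ℚ (suc t)) 1ℚ)
                  (cong (y ℚ.+_) (sym (ℕ→ℚ-suc (suc t))))
  x′ : Fin n → ℚ
  x′ i = x (suc i) ℚ.+ 1ℚ
  a : Fin n → ℚ
  a k = ℚ.- (x zero ℚ.+ ℕ→ℚ (suc (toℕ k)))
  N : Matrix (suc n)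
  N i = insertAt (λ k → (x i ℚ.- x zero) ℚ.* Q (x i) (suc (toℕ k))) (fromℕ n) 1ℚ
  reduced-column : ∀ i k → N i (inject₁ k) ≡ pochhammerMatrix (suc n) x i (inject₁ k) ℚ.+ a k ℚ.* pochhammerMatrix (suc n) x i (suc k)
  reduced-column i k = begin
    N i (inject₁ k)
      ≡⟨ insertAt-fromℕ-inject₁ _ 1ℚ k ⟩
    (x i ℚ.- x zero) ℚ.* Q (x i) (suc (toℕ k))
      ≡⟨ solve 4 (λ y x₀ s q → (y :- x₀) :* q := (y :+ s) :* q :+ (:- (x₀ :+ s)) :* q) refl
               (x i) (x zero) (ℕ→ℚ (suc (toℕ k))) (Q (x i) (suc (toℕ k))) ⟩
    (x i ℚ.+ ℕ→ℚ (suc (toℕ k))) ℚ.* Q (x i) (suc (toℕ k)) ℚ.+ a k ℚ.* Q (x i) (suc (toℕ k))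
      ≡⟨ cong (ℚ._+ a k ℚ.* Q (x i) (suc (toℕ k))) (Q-step (x i) (toℕ k) (FinP.toℕ<n k)) ⟨
    Q (x i) (toℕ k) ℚ.+ a k ℚ.* Q (x i) (suc (toℕ k))
      ≡⟨ cong (λ t → Q (x i) t ℚ.+ a k ℚ.* Q (x i) (suc (toℕ k))) (FinP.toℕ-inject₁ k) ⟨
    Q (x i) (toℕ (inject₁ k)) ℚ.+ a k ℚ.* Q (x i) (suc (toℕ k))
      ∎
  last-column : ∀ i → N i (fromℕ n) ≡ pochhammerMatrix (suc n) x i (fromℕ n)
  last-column i = begin
    N i (fromℕ n)            ≡⟨ insertAt-lookup _ (fromℕ n) 1ℚ ⟩
    1ℚ                       ≡⟨ cong (pochℚ (x i ℚ.+ ℕ→ℚ (suc n))) (ℕP.n∸n≡0 n) ⟨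
    Q (x i) n                ≡⟨ cong (Q (x i)) (FinP.toℕ-fromℕ n) ⟨
    Q (x i) (toℕ (fromℕ n))  ∎
  first-row : ∀ k → N zero (punchIn (fromℕ n) k) ≡ 0ℚ
  first-row k = trans (insertAt-punchIn _ (fromℕ n) 1ℚ k)
                      (trans (cong (ℚ._* Q (x zero) (suc (toℕ k))) (ℚP.+-inverseʳ (x zero))) (ℚP.*-zeroˡ (Q (x zero) (suc (toℕ k)))))
  minor-N : ∀ i k → minor N (fromℕ n) i k ≡ r i ℚ.* pochhammerMatrix n x′ i k
  minor-N i k = trans (insertAt-punchIn _ (fromℕ n) 1ℚ k)
                      (cong (λ c → r i ℚ.* pochℚ c (n ∸ suc (toℕ k)))
                            (trans (cong (x (suc i) ℚ.+_) (ℕ→ℚ-suc (suc (toℕ k)))) (sym (ℚP.+-assoc (x (suc i)) 1ℚ _))))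

-- The top coefficients of B

δ : ℕ → ℕ → ℕ
δ zero    zero    = 1
δ zero    (suc s) = 0
δ (suc t) zero    = 0
δ (suc t) (suc s) = δ t s

δ-≡ : ∀ {t s} → t ≡ s → δ t s ≡ 1
δ-≡ {zero}  refl = refl
δ-≡ {suc t} refl = δ-≡ {t} refl

δ-≢ : ∀ {t s} → t ≢ s → δ t s ≡ 0
δ-≢ {zero}  {zero}  t≢s = ⊥-elim (t≢s refl)
δ-≢ {zero}  {suc s} _   = refl
δ-≢ {suc t} {zero}  _   = refl
δ-≢ {suc t} {suc s} t≢s = δ-≢ (t≢s ∘ cong suc)

δ≤1 : ∀ t s → δ t s ≤ 1
δ≤1 zero    zero    = ℕP.≤-refl
δ≤1 zero    (suc s) = z≤n
δ≤1 (suc t) zero    = z≤n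
δ≤1 (suc t) (suc s) = δ≤1 t s

-- node n s t = x_{t+1} (rows counted from 0): n - 2t, plus 1 in the exceptional row t = s.
plainNode : ℕ → ℕ → ℤ
plainNode n t = + n ℤ.- + 2 ℤ.* + t

node : ℕ → ℕ → ℕ → ℤ
node n s t = plainNode n t ℤ.+ + δ t s

nodesℚ : ∀ n → ℕ → Fin n → ℚ
nodesℚ n s i = ℤ→ℚ (node n s (toℕ i))

rowDegree : ℕ → ℕ → ℕ
rowDegree s t = 1 ∸ δ t s

base-in-row-s : ∀ n s j → ℤ→ℚ (+ (n ℕ.+ 1 ℕ.+ j) ℤ.- + (2 ℕ.* s)) ≡ ℤ→ℚ (plainNode n s ℤ.+ + 1) ℚ.+ ℕ→ℚ j
base-in-row-s n s j = trans (cong ℤ→ℚ shape) (ℤ→ℚ-+ (plainNode n s ℤ.+ + 1) (+ j))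
  where
  open ℤSolver.+-*-Solver
  shape : + (n ℕ.+ 1 ℕ.+ j) ℤ.- + (2 ℕ.* s) ≡ plainNode n s ℤ.+ + 1 ℤ.+ + j
  shape = trans (cong (ℤ._-_ (+ (n ℕ.+ 1 ℕ.+ j))) (ℤP.pos-* 2 s))
                (solve 3 (λ n s j → n :+ con (+ 1) :+ j :- con (+ 2) :* s := n :- con (+ 2) :* s :+ con (+ 1) :+ j) refl (+ n) (+ s) (+ j))

base-in-other-row : ∀ n t j → ℤ→ℚ (+ (n ℕ.+ 2 ℕ.+ j) ℤ.- + (2 ℕ.* suc t)) ≡ ℤ→ℚ (plainNode n t ℤ.+ + 0) ℚ.+ ℕ→ℚ j
base-in-other-row n t j = trans (cong ℤ→ℚ shape) (ℤ→ℚ-+ (plainNode n t ℤ.+ + 0) (+ j))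
  where
  open ℤSolver.+-*-Solver
  shape : + (n ℕ.+ 2 ℕ.+ j) ℤ.- + (2 ℕ.* suc t) ≡ plainNode n t ℤ.+ + 0 ℤ.+ + j
  shape = trans (cong (ℤ._-_ (+ (n ℕ.+ 2 ℕ.+ j))) (ℤP.pos-* 2 (suc t)))
                (solve 3 (λ n t j → n :+ con (+ 2) :+ j :- con (+ 2) :* (con (+ 1) :+ t)
                                 := n :- con (+ 2) :* t :+ con (+ 0) :+ j) refl (+ n) (+ t) (+ j))

B-entry-top : ∀ n s t k → TopCoeff (B-entry n s (suc t) (suc k)) (rowDegree s t ℕ.+ k)
                                   (pochℚ (ℤ→ℚ (node n s t) ℚ.+ ℕ→ℚ (suc k)) (n ∸ suc k))
B-entry-top n s t k with suc t ℕ.≟ suc s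
... | yes refl rewrite δ-≡ {s} refl =
  subst (TopCoeff _ k) (trans (ℚP.*-identityʳ _) (cong (λ c → pochℚ c (n ∸ suc k)) (base-in-row-s n s (suc k))))
        (top-*P (top-poch-cst _ (n ∸ suc k)) (top-poch-X (ℤ→ℚ (+ (s ℕ.+ 1) ℤ.- + suc k)) k))
... | no 1+t≢1+s rewrite δ-≢ (1+t≢1+s ∘ cong suc) =
  top-reindex (ℕP.+-comm k 1)
    (subst (TopCoeff _ (k ℕ.+ 1))
           (trans (ℚP.*-identityʳ _) (trans (ℚP.*-identityʳ _) (cong (λ c → pochℚ c (n ∸ suc k)) (base-in-other-row n t (suc k)))))
           (top-*P (top-*P (top-poch-cst _ (n ∸ suc k)) (top-poch-X (ℤ→ℚ (+ (suc t ℕ.+ 1) ℤ.- + suc k)) k)) (top-monic-linear _)))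

∏ℕ : ℕ → (ℕ → ℕ) → ℕ
∏ℕ zero    f = 1
∏ℕ (suc n) f = f 0 ℕ.* ∏ℕ n (f ∘ suc)

∏ℕ-cong : ∀ n {f g : ℕ → ℕ} → (∀ i → f i ≡ g i) → ∏ℕ n f ≡ ∏ℕ n g
∏ℕ-cong zero    eq = refl
∏ℕ-cong (suc n) eq = cong₂ ℕ._*_ (eq 0) (∏ℕ-cong n (eq ∘ suc))

∏ℕ-snoc : ∀ n f → ∏ℕ (suc n) f ≡ ∏ℕ n f ℕ.* f n
∏ℕ-snoc zero    f = ℕP.*-comm (f 0) 1
∏ℕ-snoc (suc n) f = trans (cong (f 0 ℕ.*_) (∏ℕ-snoc n (f ∘ suc))) (sym (ℕP.*-assoc (f 0) _ _))

∏ℕ-update : ∀ m (f g : ℕ → ℕ) k → k < m → (∀ i → i ≢ k → f i ≡ g i) → ∏ℕ m f ℕ.* g k ≡ ∏ℕ m g ℕ.* f k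
∏ℕ-update (suc m) f g zero    _         f≡g =
  trans (cong (λ p → f 0 ℕ.* p ℕ.* g 0) (∏ℕ-cong m λ i → f≡g (suc i) λ ()))
        (solve 3 (λ a p b → a :* p :* b := b :* p :* a) refl (f 0) (∏ℕ m (g ∘ suc)) (g 0))
  where open ℕSolver.+-*-Solver
∏ℕ-update (suc m) f g (suc k) (s≤s k<m) f≡g = begin
  f 0 ℕ.* ∏ℕ m (f ∘ suc) ℕ.* g (suc k)     ≡⟨ ℕP.*-assoc (f 0) _ _ ⟩
  f 0 ℕ.* (∏ℕ m (f ∘ suc) ℕ.* g (suc k))   ≡⟨ cong₂ ℕ._*_ (f≡g 0 λ ()) (∏ℕ-update m (f ∘ suc) (g ∘ suc) k k<m f≡g′) ⟩
  g 0 ℕ.* (∏ℕ m (g ∘ suc) ℕ.* f (suc k))   ≡⟨ ℕP.*-assoc (g 0) _ _ ⟨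
  g 0 ℕ.* ∏ℕ m (g ∘ suc) ℕ.* f (suc k)     ∎
  where
  open ≡-Reasoning
  f≡g′ : ∀ i → i ≢ k → f (suc i) ≡ g (suc i)
  f≡g′ i i≢k = f≡g (suc i) (i≢k ∘ ℕP.suc-injective)

∏-ℕ→ℚ : ∀ n (f : ℕ → ℕ) → ∏ {n} (λ k → ℕ→ℚ (f (toℕ k))) ≡ ℕ→ℚ (∏ℕ n f)
∏-ℕ→ℚ zero    f = refl
∏-ℕ→ℚ (suc n) f = trans (cong (ℕ→ℚ (f 0) ℚ.*_) (∏-ℕ→ℚ n (f ∘ suc))) (sym (ℕ→ℚ-* (f 0) _))

∏ℕ-evens : ∀ n → ∏ℕ n (λ k → 2 ℕ.* suc k) ≡ 2 ℕ.^ n ℕ.* n !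
∏ℕ-evens zero    = refl
∏ℕ-evens (suc n) = begin
  ∏ℕ (suc n) (λ k → 2 ℕ.* suc k)          ≡⟨ ∏ℕ-snoc n _ ⟩
  ∏ℕ n (λ k → 2 ℕ.* suc k) ℕ.* (2 ℕ.* suc n) ≡⟨ cong (ℕ._* (2 ℕ.* suc n)) (∏ℕ-evens n) ⟩
  2 ℕ.^ n ℕ.* n ! ℕ.* (2 ℕ.* suc n)        ≡⟨ solve 3 (λ p f m → p :* f :* (con 2 :* (con 1 :+ m)) := con 2 :* p :* ((con 1 :+ m) :* f))
                                                      refl (2 ℕ.^ n) (n !) n ⟩
  2 ℕ.^ suc n ℕ.* suc n !                  ∎
  where
  open ≡-Reasoning
  open ℕSolver.+-*-Solver

∏ℕ-odds : ∀ n → ∏ℕ n (λ k → 2 ℕ.* suc k ℕ.+ 1) ≡ oddFact (suc n)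
∏ℕ-odds zero    = refl
∏ℕ-odds (suc n) = trans (∏ℕ-snoc n _) (trans (cong (ℕ._* (2 ℕ.* suc n ℕ.+ 1)) (∏ℕ-odds n)) (ℕP.*-comm (oddFact (suc n)) _))

gap : ℕ → ℕ → ℕ
gap s k = 2 ℕ.* suc k ∸ δ k s

∏ℕ-gap : ∀ m s → s ≤ m → ∏ℕ (suc m) (gap s) ℕ.* suc s ≡ 2 ℕ.^ m ℕ.* suc m ! ℕ.* (2 ℕ.* s ℕ.+ 1)
∏ℕ-gap m s s≤m = ℕP.*-cancelˡ-≡ _ _ 2 (begin
  2 ℕ.* (∏ℕ (suc m) (gap s) ℕ.* suc s)
    ≡⟨ solve 2 (λ p t → con 2 :* (p :* t) := p :* (con 2 :* t)) refl (∏ℕ (suc m) (gap s)) (suc s) ⟩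
  ∏ℕ (suc m) (gap s) ℕ.* (2 ℕ.* suc s)
    ≡⟨ ∏ℕ-update (suc m) (gap s) (λ k → 2 ℕ.* suc k) s (s≤s s≤m) (λ i i≢s → cong (2 ℕ.* suc i ∸_) (δ-≢ i≢s)) ⟩
  ∏ℕ (suc m) (λ k → 2 ℕ.* suc k) ℕ.* gap s s
    ≡⟨ cong₂ ℕ._*_ (∏ℕ-evens (suc m)) gap-diagonal ⟩
  2 ℕ.^ suc m ℕ.* suc m ! ℕ.* (2 ℕ.* s ℕ.+ 1)
    ≡⟨ solve 3 (λ p f o → con 2 :* p :* f :* o := con 2 :* (p :* f :* o)) refl (2 ℕ.^ m) (suc m !) (2 ℕ.* s ℕ.+ 1) ⟩
  2 ℕ.* (2 ℕ.^ m ℕ.* suc m ! ℕ.* (2 ℕ.* s ℕ.+ 1))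
    ∎)
  where
  open ≡-Reasoning
  open ℕSolver.+-*-Solver
  gap-diagonal : gap s s ≡ 2 ℕ.* s ℕ.+ 1
  gap-diagonal = trans (cong (2 ℕ.* suc s ∸_) (δ-≡ {s} refl))
                       (cong (_∸ 1) (solve 1 (λ s → con 2 :* (con 1 :+ s) := con 1 :+ (con 2 :* s :+ con 1)) refl s))

C2-suc : ∀ n → suc n C 2 ≡ n C 2 ℕ.+ n
C2-suc n = trans (sym (nCk+nC[k+1]≡[n+1]C[k+1] n 1)) (trans (cong (ℕ._+ n C 2) (nC1≡n n)) (ℕP.+-comm n (n C 2)))

pos-∸ : ∀ {m n} → n ≤ m → + (m ∸ n) ≡ + m ℤ.- + n
pos-∸ {m} {n} n≤m = sym (trans (ℤP.m-n≡m⊖n m n) (ℤP.⊖-≥ n≤m))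

ℕ→ℚ-*-* : ∀ a b c → ℕ→ℚ a ℚ.* ℕ→ℚ b ℚ.* ℕ→ℚ c ≡ ℕ→ℚ (a ℕ.* b ℕ.* c)
ℕ→ℚ-*-* a b c = sym (trans (ℕ→ℚ-* (a ℕ.* b) c) (cong (ℚ._* ℕ→ℚ c) (ℕ→ℚ-* a b)))

vandermonde-peel : ∀ n (x y : ℕ → ℤ) (g : ℕ → ℕ) c →
                   (∀ k → x 0 ℤ.- x (suc k) ≡ + g k) → (∀ k → x (suc k) ≡ y k ℤ.+ c) →
                   vandermonde (suc n) (ℤ→ℚ ∘ x ∘ toℕ) ≡ ℕ→ℚ (∏ℕ n g) ℚ.* vandermonde n (ℤ→ℚ ∘ y ∘ toℕ)
vandermonde-peel n x y g c gaps shift = cong₂ ℚ._*_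
  first-row
  (vandermonde-translate n (ℤ→ℚ c) λ k → trans (cong ℤ→ℚ (shift (toℕ k))) (ℤ→ℚ-+ (y (toℕ k)) c))
  where
  differences : ∀ (k : Fin n) → ℤ→ℚ (x 0) ℚ.- ℤ→ℚ (x (suc (toℕ k))) ≡ ℕ→ℚ (g (toℕ k))
  differences k = trans (sym (ℤ→ℚ-- (x 0) (x (suc (toℕ k))))) (cong ℤ→ℚ (gaps (toℕ k)))
  first-row : ∏ {n} (λ k → ℤ→ℚ (x 0) ℚ.- ℤ→ℚ (x (suc (toℕ k)))) ≡ ℕ→ℚ (∏ℕ n g)
  first-row = trans (∏-cong-≗ differences) (∏-ℕ→ℚ n g)

plainNode-shift : ∀ n k → plainNode (suc n) (suc k) ≡ plainNode n k ℤ.+ ℤ.- + 1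
plainNode-shift n k = solve 2 (λ n k → con (+ 1) :+ n :- con (+ 2) :* (con (+ 1) :+ k) := n :- con (+ 2) :* k :+ :- con (+ 1)) refl (+ n) (+ k)
  where open ℤSolver.+-*-Solver

plainNode-gap : ∀ n k → plainNode n 0 ℤ.- plainNode n (suc k) ≡ + (2 ℕ.* suc k)
plainNode-gap n k =
  trans (solve 2 (λ n k → (n :- con (+ 2) :* con (+ 0)) :- (n :- con (+ 2) :* (con (+ 1) :+ k))
                          := con (+ 2) :* (con (+ 1) :+ k)) refl (+ n) (+ k))
        (sym (ℤP.pos-* 2 (suc k)))
  where open ℤSolver.+-*-Solver

vandermonde-plainNode : ∀ n → vandermonde n (ℤ→ℚ ∘ plainNode n ∘ toℕ) ≡ ℕ→ℚ (2 ℕ.^ (n C 2) ℕ.* h n)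
vandermonde-plainNode zero    = refl
vandermonde-plainNode (suc n) = begin
  vandermonde (suc n) (ℤ→ℚ ∘ plainNode (suc n) ∘ toℕ)
    ≡⟨ vandermonde-peel n (plainNode (suc n)) (plainNode n) _ (ℤ.- + 1) (plainNode-gap (suc n)) (plainNode-shift n) ⟩
  ℕ→ℚ (∏ℕ n (λ k → 2 ℕ.* suc k)) ℚ.* vandermonde n (ℤ→ℚ ∘ plainNode n ∘ toℕ)
    ≡⟨ cong₂ ℚ._*_ (cong ℕ→ℚ (∏ℕ-evens n)) (vandermonde-plainNode n) ⟩
  ℕ→ℚ (2 ℕ.^ n ℕ.* n !) ℚ.* ℕ→ℚ (2 ℕ.^ (n C 2) ℕ.* h n)
    ≡⟨ ℕ→ℚ-* (2 ℕ.^ n ℕ.* n !) _ ⟨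
  ℕ→ℚ (2 ℕ.^ n ℕ.* n ! ℕ.* (2 ℕ.^ (n C 2) ℕ.* h n))
    ≡⟨ cong ℕ→ℚ (solve 4 (λ p f q g → p :* f :* (q :* g) := q :* p :* (g :* f)) refl (2 ℕ.^ n) (n !) (2 ℕ.^ (n C 2)) (h n)) ⟩
  ℕ→ℚ (2 ℕ.^ (n C 2) ℕ.* 2 ℕ.^ n ℕ.* (h n ℕ.* n !))
    ≡⟨ cong (λ e → ℕ→ℚ (e ℕ.* h (suc n))) (trans (sym (ℕP.^-distribˡ-+-* 2 (n C 2) n)) (cong (2 ℕ.^_) (sym (C2-suc n)))) ⟩
  ℕ→ℚ (2 ℕ.^ (suc n C 2) ℕ.* h (suc n))
    ∎
  where
  open ≡-Reasoning
  open ℕSolver.+-*-Solver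

node-gap-zero : ∀ n k → node (suc n) 0 0 ℤ.- node (suc n) 0 (suc k) ≡ + (2 ℕ.* suc k ℕ.+ 1)
node-gap-zero n k =
  trans (solve 2 (λ e₀ e₁ → (e₀ :+ con (+ 1)) :- (e₁ :+ con (+ 0)) := (e₀ :- e₁) :+ con (+ 1)) refl
                 (plainNode (suc n) 0) (plainNode (suc n) (suc k)))
        (cong (ℤ._+ + 1) (plainNode-gap (suc n) k))
  where open ℤSolver.+-*-Solver

node-shift-zero : ∀ n k → node (suc n) 0 (suc k) ≡ plainNode n k ℤ.+ ℤ.- + 1
node-shift-zero n k = trans (solve 1 (λ e → e :+ con (+ 0) := e) refl (plainNode (suc n) (suc k))) (plainNode-shift n k)
  where open ℤSolver.+-*-Solver

node-gap-suc : ∀ m s k → node (suc m) (suc s) 0 ℤ.- node (suc m) (suc s) (suc k) ≡ + gap s k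
node-gap-suc m s k = begin
  (plainNode (suc m) 0 ℤ.+ + 0) ℤ.- (plainNode (suc m) (suc k) ℤ.+ + δ k s)
    ≡⟨ solve 3 (λ e₀ e₁ d → (e₀ :+ con (+ 0)) :- (e₁ :+ d) := (e₀ :- e₁) :- d) refl
             (plainNode (suc m) 0) (plainNode (suc m) (suc k)) (+ δ k s) ⟩
  (plainNode (suc m) 0 ℤ.- plainNode (suc m) (suc k)) ℤ.- + δ k s
    ≡⟨ cong (ℤ._- + δ k s) (plainNode-gap (suc m) k) ⟩
  + (2 ℕ.* suc k) ℤ.- + δ k s
    ≡⟨ pos-∸ (ℕP.≤-trans (δ≤1 k s) (s≤s z≤n)) ⟨
  + gap s k
    ∎
  where
  open ≡-Reasoning
  open ℤSolver.+-*-Solver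

node-shift-suc : ∀ m s k → node (suc m) (suc s) (suc k) ≡ node m s k ℤ.+ ℤ.- + 1
node-shift-suc m s k = trans (cong (ℤ._+ + δ k s) (plainNode-shift m k))
                         (solve 2 (λ e d → e :+ :- con (+ 1) :+ d := e :+ d :+ :- con (+ 1)) refl (plainNode m k) (+ δ k s))
  where open ℤSolver.+-*-Solver

numerator denominator : ℕ → ℕ → ℕ
numerator   n s = 2 ℕ.^ ((n ∸ 1) C 2) ℕ.* h n ℕ.* oddFact (n ∸ s) ℕ.* oddFact s
denominator n s = (n ∸ s ∸ 1) ! ℕ.* s !

-- Multiplied out by the denominator, so that the induction only uses products of naturals.
vandermonde-nodes : ∀ n s → s < n → vandermonde n (nodesℚ n s) ℚ.* ℕ→ℚ (denominator n s) ≡ ℕ→ℚ (numerator n s)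
vandermonde-nodes (suc n) zero _ = begin
  vandermonde (suc n) (nodesℚ (suc n) 0) ℚ.* ℕ→ℚ (n ! ℕ.* 1)
    ≡⟨ cong (ℚ._* ℕ→ℚ (n ! ℕ.* 1))
            (vandermonde-peel n (node (suc n) 0) (plainNode n) _ (ℤ.- + 1) (node-gap-zero n) (node-shift-zero n)) ⟩
  ℕ→ℚ (∏ℕ n (λ k → 2 ℕ.* suc k ℕ.+ 1)) ℚ.* vandermonde n (ℤ→ℚ ∘ plainNode n ∘ toℕ) ℚ.* ℕ→ℚ (n ! ℕ.* 1)
    ≡⟨ cong₂ (λ o v → o ℚ.* v ℚ.* ℕ→ℚ (n ! ℕ.* 1)) (cong ℕ→ℚ (∏ℕ-odds n)) (vandermonde-plainNode n) ⟩
  ℕ→ℚ (oddFact (suc n)) ℚ.* ℕ→ℚ (2 ℕ.^ (n C 2) ℕ.* h n) ℚ.* ℕ→ℚ (n ! ℕ.* 1)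
    ≡⟨ ℕ→ℚ-*-* (oddFact (suc n)) _ _ ⟩
  ℕ→ℚ (oddFact (suc n) ℕ.* (2 ℕ.^ (n C 2) ℕ.* h n) ℕ.* (n ! ℕ.* 1))
    ≡⟨ cong ℕ→ℚ (solve 4 (λ o p g f → o :* (p :* g) :* (f :* con 1) := p :* (g :* f) :* o :* con 1) refl
                        (oddFact (suc n)) (2 ℕ.^ (n C 2)) (h n) (n !)) ⟩
  ℕ→ℚ (numerator (suc n) 0)
    ∎
  where
  open ≡-Reasoning
  open ℕSolver.+-*-Solver
vandermonde-nodes (suc m@(suc m′)) (suc s) (s≤s s<m) = begin
  vandermonde (suc m) (nodesℚ (suc m) (suc s)) ℚ.* ℕ→ℚ ((m ∸ s ∸ 1) ! ℕ.* (suc s ℕ.* s !))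
    ≡⟨ cong₂ ℚ._*_ (vandermonde-peel m (node (suc m) (suc s)) (node m s) (gap s) (ℤ.- + 1) (node-gap-suc m s) (node-shift-suc m s))
                   (trans (cong ℕ→ℚ (solve 3 (λ a t b → a :* (t :* b) := t :* (a :* b)) refl ((m ∸ s ∸ 1) !) (suc s) (s !)))
                          (ℕ→ℚ-* (suc s) (denominator m s))) ⟩
  ℕ→ℚ G ℚ.* V ℚ.* (ℕ→ℚ (suc s) ℚ.* ℕ→ℚ (denominator m s))
    ≡⟨ ℚ-*-interchange (ℕ→ℚ G) V (ℕ→ℚ (suc s)) (ℕ→ℚ (denominator m s)) ⟩
  ℕ→ℚ G ℚ.* ℕ→ℚ (suc s) ℚ.* (V ℚ.* ℕ→ℚ (denominator m s))
    ≡⟨ cong (ℕ→ℚ G ℚ.* ℕ→ℚ (suc s) ℚ.*_) (vandermonde-nodes m s s<m) ⟩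
  ℕ→ℚ G ℚ.* ℕ→ℚ (suc s) ℚ.* ℕ→ℚ (numerator m s)
    ≡⟨ ℕ→ℚ-*-* G (suc s) (numerator m s) ⟩
  ℕ→ℚ (G ℕ.* suc s ℕ.* numerator m s)
    ≡⟨ cong (λ e → ℕ→ℚ (e ℕ.* numerator m s)) (∏ℕ-gap m′ s (ℕ.s≤s⁻¹ s<m)) ⟩
  ℕ→ℚ (2 ℕ.^ m′ ℕ.* m ! ℕ.* (2 ℕ.* s ℕ.+ 1) ℕ.* numerator m s)
    ≡⟨ cong ℕ→ℚ numerator-step ⟩
  ℕ→ℚ (numerator (suc m) (suc s))
    ∎
  where
  open ≡-Reasoning
  open ℕSolver.+-*-Solver
  G : ℕ
  G = ∏ℕ m (gap s)
  V : ℚ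
  V = vandermonde m (nodesℚ m s)
  numerator-step : 2 ℕ.^ m′ ℕ.* m ! ℕ.* (2 ℕ.* s ℕ.+ 1) ℕ.* numerator m s ≡ numerator (suc m) (suc s)
  numerator-step = begin
    2 ℕ.^ m′ ℕ.* m ! ℕ.* (2 ℕ.* s ℕ.+ 1) ℕ.* (2 ℕ.^ (m′ C 2) ℕ.* h m ℕ.* oddFact (m ∸ s) ℕ.* oddFact s)
      ≡⟨ solve 7 (λ p f t q g o o′ → p :* f :* t :* (q :* g :* o :* o′) := q :* p :* (g :* f) :* o :* (t :* o′)) refl
               (2 ℕ.^ m′) (m !) (2 ℕ.* s ℕ.+ 1) (2 ℕ.^ (m′ C 2)) (h m) (oddFact (m ∸ s)) (oddFact s) ⟩
    2 ℕ.^ (m′ C 2) ℕ.* 2 ℕ.^ m′ ℕ.* (h m ℕ.* m !) ℕ.* oddFact (m ∸ s) ℕ.* ((2 ℕ.* s ℕ.+ 1) ℕ.* oddFact s)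
      ≡⟨ cong (λ e → e ℕ.* h (suc m) ℕ.* oddFact (m ∸ s) ℕ.* oddFact (suc s))
              (trans (sym (ℕP.^-distribˡ-+-* 2 (m′ C 2) m′)) (cong (2 ℕ.^_) (sym (C2-suc m′)))) ⟩
    numerator (suc m) (suc s)
      ∎

h-nonZero : ∀ n → ℕ.NonZero (h n)
h-nonZero zero    = _
h-nonZero (suc n) = ℕP.m*n≢0 (h n) (n !) {{h-nonZero n}} {{n ℕP.!≢0}}

oddFact-nonZero : ∀ k → ℕ.NonZero (oddFact k)
oddFact-nonZero zero    = _
oddFact-nonZero (suc k) = ℕP.m*n≢0 (2 ℕ.* k ℕ.+ 1) (oddFact k) {{ℕ.>-nonZero (ℕP.m≤n+m 1 (2 ℕ.* k))}} {{oddFact-nonZero k}}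

numerator-nonZero : ∀ n s → ℕ.NonZero (numerator n s)
numerator-nonZero n s = ℕP.m*n≢0 (p ℕ.* h n ℕ.* oddFact (n ∸ s)) (oddFact s) {{p·h·o≢0}} {{oddFact-nonZero s}}
  where
  p : ℕ
  p = 2 ℕ.^ ((n ∸ 1) C 2)
  p·h≢0 : ℕ.NonZero (p ℕ.* h n)
  p·h≢0 = ℕP.m*n≢0 p (h n) {{ℕP.m^n≢0 2 ((n ∸ 1) C 2)}} {{h-nonZero n}}
  p·h·o≢0 : ℕ.NonZero (p ℕ.* h n ℕ.* oddFact (n ∸ s))
  p·h·o≢0 = ℕP.m*n≢0 (p ℕ.* h n) (oddFact (n ∸ s)) {{p·h≢0}} {{oddFact-nonZero (n ∸ s)}}

lemma10 : (n s : ℕ) → 1 ≤ n → s < n → leadCoeff (det n (B n s)) ≡ rhs n s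
lemma10 n s _ s<n = trans (leadCoeff-top det-top top≢0) top≡rhs
  where
  det-top : TopCoeff (det n (B n s)) (ℕΣ.sum {n} (rowDegree s ∘ toℕ) ℕ.+ ℕΣ.sum {n} toℕ)
                     (detℚ (pochhammerMatrix n (nodesℚ n s)))
  det-top = top-det n {r = rowDegree s ∘ toℕ} {c = toℕ} λ i j → B-entry-top n s (toℕ i) (toℕ j)
  instance
    denominator≢0 : ℕ.NonZero (denominator n s)
    denominator≢0 = (n ∸ s ∸ 1) ℕP.!* s !≢0
  top≡rhs : detℚ (pochhammerMatrix n (nodesℚ n s)) ≡ rhs n s
  top≡rhs = trans (detℚ-pochhammer n (nodesℚ n s))
                  (q*d≡m⇒q≡m/d _ (numerator n s) (denominator n s) (vandermonde-nodes n s s<n))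
  top≢0 : ¬ detℚ (pochhammerMatrix n (nodesℚ n s)) ≡ 0ℚ
  top≢0 = m/d≢0 (numerator n s) (denominator n s) {{numerator-nonZero n s}} ∘ trans (sym top≡rhs)
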